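{- If $M$ is a uniform matroid on a finite set $E$, then $\ell(M)=0$, i.e., $M$ has no locked subsets.
   Context: For a matroid $M$ on $E$ with rank function $r$ and dual $M^*$ with rank function $r^*$: if $M$ is 2-connected, a subset $L\subset E$ is locked if $M|L$ and $M^*|(E\setminus L)$ are 2-connected and $\min\{r(L),r^*(E\setminus L)\}\geq2$; if $M$ is not 2-connected, the class of locked subsets of $M$ is the union of the classes of locked subsets of its 2-connected components. $\ell(M)$ denotes the number of locked subsets of $M$. -}

module Defs where

open import Data.Nat using (ℕ; suc; _+_; _∸_; _≤_; _⊓_)
open import Data.Fin.Subset using (Subset; _⊆_; _∪_; _∩_; _─_; ∣_∣; Nonempty; ⊤)
open import Data.Product using (Σ; _×_)
open import Data.Sum using (_⊎_)
open import Relation.Nullary using (¬_)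
open import Relation.Binary.PropositionalEquality using (_≡_)

record Matroid (n : ℕ) : Set where
  field
    rank       : Subset n → ℕ
    rank-≤-card : ∀ X → rank X ≤ ∣ X ∣
    rank-mono  : ∀ {X Y} → X ⊆ Y → rank X ≤ rank Y
    rank-submod : ∀ X Y → rank (X ∪ Y) + rank (X ∩ Y) ≤ rank X + rank Y
open Matroid public

IsUniform : ∀ {n} → Matroid n → Set
IsUniform {n} M = Σ ℕ λ k → ∀ (X : Subset n) → rank M X ≡ k ⊓ ∣ X ∣

-- Rank function of the dual of the restriction M|S (ground set S):
-- r*_S(X) = |X| + r(S \ X) − r(S)   for X ⊆ S.
dualRankIn : ∀ {n} → (Subset n → ℕ) → Subset n → Subset n → ℕ
dualRankIn r S X = (∣ X ∣ + r (S ─ X)) ∸ r S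

-- The matroid on ground set S with rank function f (restricted to subsets
-- of S) is 2-connected (Tutte): it has no 1-separation, i.e. no partition
-- (X, S \ X) with both parts nonempty and f(X) + f(S \ X) − f(S) < 1.
TwoConnectedOn : ∀ {n} → (Subset n → ℕ) → Subset n → Set
TwoConnectedOn f S = ∀ X → X ⊆ S → Nonempty X → Nonempty (S ─ X) →
  suc (f S) ≤ f X + f (S ─ X)

-- Locked subsets of the 2-connected matroid M|S  (here L ⊆ S, and the
-- complement is taken inside S; M|S|L = M|L and (M|S)* has rank dualRankIn r S).
LockedIn : ∀ {n} → (Subset n → ℕ) → Subset n → Subset n → Set
LockedIn r S L =
  L ⊆ S ×
  TwoConnectedOn r L ×
  TwoConnectedOn (dualRankIn r S) (S ─ L) ×
  2 ≤ r L ×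
  2 ≤ dualRankIn r S (S ─ L)

IsComponent : ∀ {n} → Matroid n → Subset n → Set
IsComponent {n} M C =
  Nonempty C × TwoConnectedOn (rank M) C ×
  (∀ (D : Subset n) → C ⊆ D → TwoConnectedOn (rank M) D → D ≡ C)

Locked : ∀ {n} → Matroid n → Subset n → Set
Locked {n} M L =
  (TwoConnectedOn (rank M) ⊤ × LockedIn (rank M) ⊤ L)
  ⊎ (¬ TwoConnectedOn (rank M) ⊤ ×
     Σ (Subset n) λ C → IsComponent M C × LockedIn (rank M) C L)

-- Both halves of a locked subset L ⊆ S would have to be free.  A free
-- (independent) set with at least two elements splits off a singleton
-- without loss of rank, so it is never 2-connected.  In U_{k,n} the
-- connected set L with r(L) ≥ 2 therefore has more than k elements, so it
-- spans S; then S ∖ L is independent in (M|S)*, and being of dual rank ≥ 2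
-- it is not 2-connected there either.
module Submission where

open import Defs
open import Data.Nat using (ℕ; suc; _+_; _∸_; _≤_; _<_; _≤?_)
open import Data.Nat.Properties
open import Data.Bool using (true; false)
open import Data.Vec.Base using ([]; _∷_; here)
open import Data.Fin.Subset using (Subset; _⊆_; _─_; ∣_∣; Nonempty; ⁅_⁆; _∈_; ⊤)
open import Data.Fin.Subset.Properties
  using (drop-∷-⊆; p─q⊆p; p⊆q⇒∣p∣≤∣q∣; nonempty?; Empty-unique; ∣⊥∣≡0;
         x∈⁅x⁆; x∈⁅y⁆⇒x≡y; ∣⁅x⁆∣≡1)
open import Data.Product using (Σ; _×_; _,_)
open import Data.Sum using (inj₁; inj₂)
open import Relation.Nullary using (¬_; yes; no; contradiction)
open import Relation.Binary.PropositionalEquality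

∣p∣+∣q─p∣≡∣q∣ : ∀ {n} {p q : Subset n} → p ⊆ q → ∣ p ∣ + ∣ q ─ p ∣ ≡ ∣ q ∣
∣p∣+∣q─p∣≡∣q∣ {p = []}        {[]}        _   = refl
∣p∣+∣q─p∣≡∣q∣ {p = true ∷ p}  {true ∷ q}  p⊆q = cong suc (∣p∣+∣q─p∣≡∣q∣ (drop-∷-⊆ p⊆q))
∣p∣+∣q─p∣≡∣q∣ {p = true ∷ p}  {false ∷ q} p⊆q = contradiction (p⊆q here) λ ()
∣p∣+∣q─p∣≡∣q∣ {p = false ∷ p} {true ∷ q}  p⊆q =
  trans (+-suc ∣ p ∣ ∣ q ─ p ∣) (cong suc (∣p∣+∣q─p∣≡∣q∣ (drop-∷-⊆ p⊆q)))
∣p∣+∣q─p∣≡∣q∣ {p = false ∷ p} {false ∷ q} p⊆q = ∣p∣+∣q─p∣≡∣q∣ (drop-∷-⊆ p⊆q)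

q─[q─p]≡p : ∀ {n} {p q : Subset n} → p ⊆ q → q ─ (q ─ p) ≡ p
q─[q─p]≡p {p = []}        {[]}        _   = refl
q─[q─p]≡p {p = true ∷ p}  {true ∷ q}  p⊆q = cong (true ∷_) (q─[q─p]≡p (drop-∷-⊆ p⊆q))
q─[q─p]≡p {p = true ∷ p}  {false ∷ q} p⊆q = contradiction (p⊆q here) λ ()
q─[q─p]≡p {p = false ∷ p} {true ∷ q}  p⊆q = cong (false ∷_) (q─[q─p]≡p (drop-∷-⊆ p⊆q))
q─[q─p]≡p {p = false ∷ p} {false ∷ q} p⊆q = cong (false ∷_) (q─[q─p]≡p (drop-∷-⊆ p⊆q))

0<∣p∣⇒Nonempty : ∀ {n} (p : Subset n) → 0 < ∣ p ∣ → Nonempty p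
0<∣p∣⇒Nonempty {n} p 0<∣p∣ with nonempty? p
... | yes p≢∅ = p≢∅
... | no  p≡∅ = contradiction (trans (cong ∣_∣ (Empty-unique p≡∅)) (∣⊥∣≡0 n)) (m<n⇒n≢0 0<∣p∣)

2≤∣p∣⇒bipartition : ∀ {n} (p : Subset n) → 2 ≤ ∣ p ∣ →
  Σ (Subset n) λ q → q ⊆ p × Nonempty q × Nonempty (p ─ q)
2≤∣p∣⇒bipartition p 2≤∣p∣ with 0<∣p∣⇒Nonempty p (≤-trans (n≤1+n 1) 2≤∣p∣)
... | i , i∈p = ⁅ i ⁆ , ⁅i⁆⊆p , (i , x∈⁅x⁆ i) , 0<∣p∣⇒Nonempty (p ─ ⁅ i ⁆) 0<∣p─i∣
  where
  ⁅i⁆⊆p : ⁅ i ⁆ ⊆ p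
  ⁅i⁆⊆p {x} x∈⁅i⁆ = subst (_∈ p) (sym (x∈⁅y⁆⇒x≡y i x∈⁅i⁆)) i∈p
  1+∣p─i∣≡∣p∣ : 1 + ∣ p ─ ⁅ i ⁆ ∣ ≡ ∣ p ∣
  1+∣p─i∣≡∣p∣ = trans (cong (_+ ∣ p ─ ⁅ i ⁆ ∣) (sym (∣⁅x⁆∣≡1 i))) (∣p∣+∣q─p∣≡∣q∣ ⁅i⁆⊆p)
  0<∣p─i∣ : 0 < ∣ p ─ ⁅ i ⁆ ∣
  0<∣p─i∣ = +-cancelˡ-≤ 1 1 _ (subst (2 ≤_) (sym 1+∣p─i∣≡∣p∣) 2≤∣p∣)

independent⇒¬TwoConnectedOn : ∀ {n} {f : Subset n → ℕ} {T : Subset n} →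
  (∀ X → f X ≤ ∣ X ∣) → 2 ≤ ∣ T ∣ → f T ≡ ∣ T ∣ → ¬ TwoConnectedOn f T
independent⇒¬TwoConnectedOn {f = f} {T} f≤∣∣ 2≤∣T∣ fT≡∣T∣ T-conn
  with 2≤∣p∣⇒bipartition T 2≤∣T∣
... | X , X⊆T , X≢∅ , T─X≢∅ = <-irrefl refl (≤-trans (T-conn X X⊆T X≢∅ T─X≢∅) parts≤fT)
  where
  parts≤fT : f X + f (T ─ X) ≤ f T
  parts≤fT = begin
    f X + f (T ─ X)     ≤⟨ +-mono-≤ (f≤∣∣ X) (f≤∣∣ (T ─ X)) ⟩
    ∣ X ∣ + ∣ T ─ X ∣   ≡⟨ ∣p∣+∣q─p∣≡∣q∣ X⊆T ⟩
    ∣ T ∣               ≡⟨ sym fT≡∣T∣ ⟩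
    f T                 ∎
    where open ≤-Reasoning

dualRankIn-≤-card : ∀ {n} (M : Matroid n) (S X : Subset n) → dualRankIn (rank M) S X ≤ ∣ X ∣
dualRankIn-≤-card M S X = begin
  ∣ X ∣ + rank M (S ─ X) ∸ rank M S   ≤⟨ ∸-monoˡ-≤ (rank M S) (+-monoʳ-≤ ∣ X ∣ (rank-mono M (p─q⊆p S X))) ⟩
  ∣ X ∣ + rank M S ∸ rank M S         ≡⟨ m+n∸n≡m ∣ X ∣ (rank M S) ⟩
  ∣ X ∣                               ∎
  where open ≤-Reasoning

spanning⇒dual-independent : ∀ {n} (r : Subset n → ℕ) {S L : Subset n} → L ⊆ S →
  r L ≡ r S → dualRankIn r S (S ─ L) ≡ ∣ S ─ L ∣
spanning⇒dual-independent r {S} {L} L⊆S rL≡rS = begin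
  ∣ S ─ L ∣ + r (S ─ (S ─ L)) ∸ r S   ≡⟨ cong (λ Y → ∣ S ─ L ∣ + r Y ∸ r S) (q─[q─p]≡p L⊆S) ⟩
  ∣ S ─ L ∣ + r L ∸ r S               ≡⟨ cong (λ m → ∣ S ─ L ∣ + m ∸ r S) rL≡rS ⟩
  ∣ S ─ L ∣ + r S ∸ r S               ≡⟨ m+n∸n≡m ∣ S ─ L ∣ (r S) ⟩
  ∣ S ─ L ∣                           ∎
  where open ≡-Reasoning

uniform⇒¬LockedIn : ∀ {n} (M : Matroid n) → IsUniform M → ∀ S L → ¬ LockedIn (rank M) S L
uniform⇒¬LockedIn M (k , r≡k⊓∣∣) S L (L⊆S , L-conn , S─L-coconn , 2≤rL , 2≤r*[S─L]) =
  independent⇒¬TwoConnectedOn (dualRankIn-≤-card M S) 2≤∣S─L∣ S─L-coindependent S─L-coconn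
  where
  r = rank M
  k<∣L∣ : k < ∣ L ∣
  k<∣L∣ with ∣ L ∣ ≤? k
  ... | no  ∣L∣≰k = ≰⇒> ∣L∣≰k
  ... | yes ∣L∣≤k = contradiction L-conn
        (independent⇒¬TwoConnectedOn (rank-≤-card M) (≤-trans 2≤rL (rank-≤-card M L))
          (trans (r≡k⊓∣∣ L) (m≥n⇒m⊓n≡n ∣L∣≤k)))
  k≤∣X∣⇒r≡k : ∀ {X} → k ≤ ∣ X ∣ → r X ≡ k
  k≤∣X∣⇒r≡k k≤∣X∣ = trans (r≡k⊓∣∣ _) (m≤n⇒m⊓n≡m k≤∣X∣)
  L-spans-S : r L ≡ r S
  L-spans-S = trans (k≤∣X∣⇒r≡k (<⇒≤ k<∣L∣))
    (sym (k≤∣X∣⇒r≡k (≤-trans (<⇒≤ k<∣L∣) (p⊆q⇒∣p∣≤∣q∣ L⊆S))))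
  S─L-coindependent : dualRankIn r S (S ─ L) ≡ ∣ S ─ L ∣
  S─L-coindependent = spanning⇒dual-independent r L⊆S L-spans-S
  2≤∣S─L∣ : 2 ≤ ∣ S ─ L ∣
  2≤∣S─L∣ = subst (2 ≤_) S─L-coindependent 2≤r*[S─L]

corollary3p8 : ∀ {n : ℕ} (M : Matroid n) → IsUniform M →
    ∀ (L : Subset n) → ¬ Locked M L
corollary3p8 M u L (inj₁ (_ , L-locked))         = uniform⇒¬LockedIn M u ⊤ L L-locked
corollary3p8 M u L (inj₂ (_ , C , _ , L-locked)) = uniform⇒¬LockedIn M u C L L-locked
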